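{- Let $f_1,\dots,f_t$ be functions from $\{a_1,\dots,a_n\}$ to $\{b_1,\dots,b_m\}$, where $d\le n$ and $d\le m$. Then $$\big|B_{(m,d)}^{\{a_1,\dots,a_n\}}(f_1,\dots,f_t)\big|=\sum_{i=1}^t S_i ,$$ where $S_1=\binom{m-1}{d-1}^n$ and, for every $i\ge 2$, $$S_i=\sum_{J\subseteq\{1,\dots,i-1\}}(-1)^{|J|}\prod_{p=1}^{|J|+1}\binom{m-p}{d-p}^{\,n^{(p)}_{J\cup\{i\}}} .$$ Written out, $$S_i=\binom{m-1}{d-1}^n-\sum_{j=1}^{i-1}\binom{m-2}{d-2}^{n^{(2)}_{\{j,i\}}}\binom{m-1}{d-1}^{n^{(1)}_{\{j,i\}}}+\sum_{1\le j<k<i}\binom{m-3}{d-3}^{n^{(3)}_{\{j,k,i\}}}\binom{m-2}{d-2}^{n^{(2)}_{\{j,k,i\}}}\binom{m-1}{d-1}^{n^{(1)}_{\{j,k,i\}}}-\cdots+(-1)^{i+1}\prod_{p=1}^{i}\binom{m-p}{d-p}^{n^{(p)}_{\{1,\dots,i\}}} .$$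
   Context: For a function $f$ from $\{a_1,\dots,a_n\}$ to $\{b_1,\dots,b_m\}$ and an integer $d\le m$, an $(m,d)$-related sequence to $f$ is a sequence $\{L_i\}_{i=1}^n$ of subsets of $\{b_1,\dots,b_m\}$ with $|L_i|=d$ and $f(a_i)\in L_i$ for every $i$. $\mathcal{L}^{\{a_1,\dots,a_n\}}_{(m,d)}(f)$ denotes the set of all such sequences. For functions $f_1,\dots,f_t$, $$B_{(m,d)}^{\{a_1,\dots,a_n\}}(f_1,\dots,f_t)=\bigcup_{i=1}^t\mathcal{L}^{\{a_1,\dots,a_n\}}_{(m,d)}(f_i).$$ For a nonempty index set $J\subseteq\{1,\dots,t\}$ and an integer $p\ge1$, let $$n^{(p)}_J=\big|\{a\in\{a_1,\dots,a_n\}: |\{f_j(a):j\in J\}|=p\}\big|.$$ Conventions: $\binom{x}{y}=0$ when $y<0$ or $y>x$, and $0^0=1$. -}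

module Defs where

open import Data.Nat using (ℕ; zero; suc; _∸_; _^_; _≤?_; _<?_; _<_; _*_)
open import Data.Nat.Combinatorics using (_C_)
import Data.Nat.Properties as ℕP
open import Data.Integer as ℤ using (ℤ; +_)
open import Data.Fin using (Fin; toℕ)
import Data.Fin.Properties as FinP
open import Data.Fin.Subset using (Subset; inside; outside; _∈_; _∪_; ⁅_⁆; ∣_∣)
open import Data.Fin.Subset.Properties using (_∈?_)
open import Data.Vec using (Vec; []; _∷_; lookup; tabulate)
open import Data.List using (List; []; _∷_; [_]; map; filter; length; allFin; upTo; foldr; cartesianProductWith)
open import Data.Product using (∃-syntax; _×_; _,_)
open import Relation.Nullary using (Dec; does)
open import Relation.Nullary.Decidable using (_×-dec_; _→-dec_)
open import Relation.Unary using (Decidable)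
open import Relation.Binary.PropositionalEquality using (_≡_)
open import Data.Bool using (if_then_else_)

-- Domain {a_1..a_n} = Fin n, codomain {b_1..b_m} = Fin m.
-- A subset of the codomain is a  Subset m  (characteristic vector).
-- A sequence {L_i}_{i=1}^n of subsets is a  Vec (Subset m) n .

Seq : ℕ → ℕ → Set
Seq n m = Vec (Subset m) n

allSubsets : ∀ m → List (Subset m)
allSubsets zero    = [ [] ]
allSubsets (suc m) =
  cartesianProductWith _∷_ (outside ∷ inside ∷ []) (allSubsets m)

allSeqs : ∀ n m → List (Seq n m)
allSeqs zero    m = [ [] ]
allSeqs (suc n) m = cartesianProductWith _∷_ (allSubsets m) (allSeqs n m)

Related : ∀ {n m} (d : ℕ) (f : Fin n → Fin m) (L : Seq n m) → Set
Related d f L = ∀ i → ∣ lookup L i ∣ ≡ d × f i ∈ lookup L i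

related? : ∀ {n m} (d : ℕ) (f : Fin n → Fin m) → Decidable (Related d f)
related? d f L = FinP.all? λ i → (∣ lookup L i ∣ ℕP.≟ d) ×-dec (f i ∈? lookup L i)

InB : ∀ {t n m} (d : ℕ) (fs : Fin t → Fin n → Fin m) (L : Seq n m) → Set
InB d fs L = ∃[ j ] Related d (fs j) L

inB? : ∀ {t n m} (d : ℕ) (fs : Fin t → Fin n → Fin m) → Decidable (InB d fs)
inB? d fs L = FinP.any? λ j → related? d (fs j) L

cardB : ∀ {t n m} (d : ℕ) (fs : Fin t → Fin n → Fin m) → ℕ
cardB {t} {n} {m} d fs = length (filter (inB? d fs) (allSeqs n m))

imageAt : ∀ {t n m} (fs : Fin t → Fin n → Fin m) (J : Subset t) (a : Fin n) → Subset m
imageAt fs J a =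
  tabulate λ b → does (FinP.any? λ j → (j ∈? J) ×-dec (fs j a FinP.≟ b))

nJ : ∀ {t n m} (fs : Fin t → Fin n → Fin m) (J : Subset t) (p : ℕ) → ℕ
nJ {n = n} fs J p = length (filter (λ a → ∣ imageAt fs J a ∣ ℕP.≟ p) (allFin n))

-- binom(m-p, d-p) with the convention binom(x,y) = 0 for y < 0.
-- (Under d ≤ m, p ≤ d implies m - p ≥ 0, so no other truncation occurs.)
binomP : (m d p : ℕ) → ℕ
binomP m d p = if does (p ≤? d) then (m ∸ p) C (d ∸ p) else 0

sumℤ : List ℤ → ℤ
sumℤ = foldr ℤ._+_ (+ 0)

prodℕ : List ℕ → ℕ
prodℕ = foldr _*_ 1

sign : ℕ → ℤ
sign k = (ℤ.- (+ 1)) ℤ.^ k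

BelowIdx : ∀ {t} (i : Fin t) (J : Subset t) → Set
BelowIdx i J = ∀ j → j ∈ J → toℕ j Data.Nat.< toℕ i

belowIdx? : ∀ {t} (i : Fin t) → Decidable (BelowIdx i)
belowIdx? i J = FinP.all? λ j → (j ∈? J) →-dec (toℕ j <? toℕ i)

termS : ∀ {t n m} (d : ℕ) (fs : Fin t → Fin n → Fin m) (i : Fin t) (J : Subset t) → ℤ
termS {m = m} d fs i J =
  sign ∣ J ∣ ℤ.* + prodℕ (map (λ p → binomP m d p ^ nJ fs (J ∪ ⁅ i ⁆) p)
                              (map suc (upTo (suc ∣ J ∣))))

-- S_i (uniform formula; for i = 1 only J = ∅ occurs, giving binom(m-1,d-1)^n)
S : ∀ {t n m} (d : ℕ) (fs : Fin t → Fin n → Fin m) (i : Fin t) → ℤ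
S {t} d fs i = sumℤ (map (termS d fs i) (filter (belowIdx? i) (allSubsets t)))

sumS : ∀ {t n m} (d : ℕ) (fs : Fin t → Fin n → Fin m) → ℤ
sumS {t} d fs = sumℤ (map (S d fs) (allFin t))

module Submission where

-- Let W(L) = {j : L is (m,d)-related to f_j}, so that L ∈ B iff W(L) ≠ ∅.
-- Classifying a nonempty W(L) by its least element i and expanding "no element of W(L)
-- lies below i" by inclusion–exclusion (Σ_{J ⊆ X} (-1)^{|J|} = [X = ∅]) gives
--   [L ∈ B] = Σ_i Σ_{J ⊆ {j < i}} (-1)^{|J|} [J ∪ {i} ⊆ W(L)].
-- Summing over all sequences L and exchanging the sums reduces the theorem to counting,
-- for K = J ∪ {i}, the sequences related to every f_j with j ∈ K.  Such an L is a free
-- choice, for each a, of a d-element set containing the image {f_j(a) : j ∈ K}; there are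
-- binom(m-p, d-p) such sets when that image has p elements, and grouping the entries a by
-- p ∈ {1, …, |J|+1} turns the product over a into ∏_p binom(m-p, d-p)^{n^{(p)}_K}.

open import Defs
open import Level using (Level)
open import Data.Nat using (ℕ; zero; suc; _≤_; _<_; z≤n; s≤s; _<?_; _≟_; _^_)
import Data.Nat.Properties as ℕP
open import Data.Nat.Combinatorics using (_C_; nCk+nC[k+1]≡[n+1]C[k+1])
open import Data.Integer using (ℤ)
import Data.Integer.Properties as ℤP
open import Data.Bool using (Bool; true; false; _∧_)
import Data.Bool.Properties as Bool
open import Data.List using (List; []; _∷_; _++_; map; foldr; filter; length; allFin; upTo; cartesianProductWith)
import Data.List.Properties as List
open import Data.List.Membership.Propositional using () renaming (_∈_ to _∈ₗ_; _∉_ to _∉ₗ_)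
open import Data.List.Membership.Propositional.Properties using (∈-map⁺; ∈-upTo⁺)
import Data.List.Relation.Unary.Any as Any
open import Data.List.Relation.Unary.AllPairs using (_∷_)
open import Data.List.Relation.Unary.Unique.Propositional using (Unique)
import Data.List.Relation.Unary.Unique.Propositional.Properties as Unique
open import Data.Fin as Fin using (Fin; toℕ)
import Data.Fin.Properties as Fin
open import Data.Fin.Subset using (Subset; inside; outside; ⊥; _∩_; _∪_; ⁅_⁆; _∈_; _⊆_; ∣_∣; Nonempty)
open import Data.Fin.Subset.Properties
  using (_∈?_; _⊆?_; nonempty?; p∩q⊆p; p∩q⊆q; x∈p∩q⁺; x∈p∪q⁺; x∈p∪q⁻; x∈⁅x⁆; x∈⁅y⁆⇒x≡y;
         ∣p∣≤n; p⊆q⇒∣p∣≤∣q∣; ∣⁅x⁆∣≡1; ∣⊥∣≡0)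
open import Data.Vec using ([]; _∷_; lookup; tabulate; here; there)
import Data.Vec.Properties as Vec
open import Data.Product using (∃; _×_; _,_; proj₁; proj₂)
open import Data.Sum using (inj₁; inj₂)
open import Data.Empty using (⊥-elim)
open import Function using (_∘_; id; _⇔_; mk⇔; Equivalence)
open import Algebra.Bundles using (CommutativeSemiring)
import Algebra.Properties.CommutativeSemigroup as CommutativeSemigroup
open import Function.Properties.Equivalence using () renaming (sym to ⇔-sym)
open import Relation.Nullary using (Dec; yes; does; ¬_)
open import Relation.Nullary.Decidable using (_×-dec_; dec-true; does-⇔)
open import Relation.Unary using (Pred; Decidable)
open import Relation.Binary.PropositionalEquality using (_≡_)
import Relation.Binary.PropositionalEquality as ≡

map-allFin-suc : ∀ {a} {A : Set a} {n} (f : Fin (suc n) → A) →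
  map f (allFin (suc n)) ≡ f Fin.zero ∷ map (f ∘ Fin.suc) (allFin n)
map-allFin-suc f = ≡.cong (f Fin.zero ∷_)
  (≡.trans (List.map-tabulate Fin.suc f) (≡.sym (List.map-tabulate id (f ∘ Fin.suc))))

module FiniteSums {c ℓ} (R : CommutativeSemiring c ℓ) where

  open CommutativeSemiring R hiding (zero)
  open import Relation.Binary.Reasoning.Setoid setoid

  private variable
    a : Level
    A B C : Set a

  ∑ : (A → Carrier) → List A → Carrier
  ∑ f xs = foldr _+_ 0# (map f xs)

  𝟙 : Bool → Carrier
  𝟙 true  = 1#
  𝟙 false = 0#

  𝟙-∧ : ∀ x y → 𝟙 (x ∧ y) ≈ 𝟙 x * 𝟙 y
  𝟙-∧ true  y = sym (*-identityˡ (𝟙 y))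
  𝟙-∧ false y = sym (zeroˡ (𝟙 y))

  𝟙-×⇔ : ∀ {p q r} {P : Set p} {Q : Set q} {R : Set r} → P ⇔ (Q × R) →
    (P? : Dec P) (Q? : Dec Q) (R? : Dec R) → 𝟙 (does P?) ≈ 𝟙 (does Q?) * 𝟙 (does R?)
  𝟙-×⇔ P⇔Q×R P? Q? R? =
    trans (reflexive (≡.cong 𝟙 (does-⇔ P⇔Q×R P? (Q? ×-dec R?)))) (𝟙-∧ (does Q?) (does R?))

  ∑-cong : {f g : A → Carrier} → (∀ x → f x ≈ g x) → ∀ xs → ∑ f xs ≈ ∑ g xs
  ∑-cong f≈g []       = refl
  ∑-cong f≈g (x ∷ xs) = +-cong (f≈g x) (∑-cong f≈g xs)

  ∑-zero : {f : A → Carrier} → (∀ x → f x ≈ 0#) → ∀ xs → ∑ f xs ≈ 0#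
  ∑-zero f≈0 []       = refl
  ∑-zero f≈0 (x ∷ xs) = trans (+-cong (f≈0 x) (∑-zero f≈0 xs)) (+-identityˡ 0#)

  ∑-map : (f : B → Carrier) (g : A → B) (xs : List A) → ∑ f (map g xs) ≡ ∑ (f ∘ g) xs
  ∑-map f g xs = ≡.cong (foldr _+_ 0#) (≡.sym (List.map-∘ xs))

  ∑-++ : (f : A → Carrier) (xs ys : List A) → ∑ f (xs ++ ys) ≈ ∑ f xs + ∑ f ys
  ∑-++ f []       ys = sym (+-identityˡ (∑ f ys))
  ∑-++ f (x ∷ xs) ys = trans (+-congˡ (∑-++ f xs ys)) (sym (+-assoc (f x) (∑ f xs) (∑ f ys)))

  ∑-+ : (f g : A → Carrier) (xs : List A) → ∑ (λ x → f x + g x) xs ≈ ∑ f xs + ∑ g xs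
  ∑-+ f g []       = sym (+-identityˡ 0#)
  ∑-+ f g (x ∷ xs) = begin
    (f x + g x) + ∑ (λ x → f x + g x) xs  ≈⟨ +-congˡ (∑-+ f g xs) ⟩
    (f x + g x) + (∑ f xs + ∑ g xs)       ≈⟨ +-assoc (f x) (g x) _ ⟩
    f x + (g x + (∑ f xs + ∑ g xs))       ≈⟨ +-congˡ (x+[y+z]≈y+[x+z] (g x) (∑ f xs) (∑ g xs)) ⟩
    f x + (∑ f xs + (g x + ∑ g xs))       ≈⟨ sym (+-assoc (f x) _ _) ⟩
    (f x + ∑ f xs) + (g x + ∑ g xs)       ∎
    where
    x+[y+z]≈y+[x+z] : ∀ x y z → x + (y + z) ≈ y + (x + z)
    x+[y+z]≈y+[x+z] x y z = trans (sym (+-assoc x y z)) (trans (+-congʳ (+-comm x y)) (+-assoc y x z))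

  ∑-*ˡ : (k : Carrier) (f : A → Carrier) (xs : List A) → k * ∑ f xs ≈ ∑ (λ x → k * f x) xs
  ∑-*ˡ k f []       = zeroʳ k
  ∑-*ˡ k f (x ∷ xs) = trans (distribˡ k (f x) (∑ f xs)) (+-congˡ (∑-*ˡ k f xs))

  ∑-*ʳ : (k : Carrier) (f : A → Carrier) (xs : List A) → ∑ f xs * k ≈ ∑ (λ x → f x * k) xs
  ∑-*ʳ k f xs = trans (*-comm (∑ f xs) k) (trans (∑-*ˡ k f xs) (∑-cong (λ x → *-comm k (f x)) xs))

  ∑-swap : (f : A → B → Carrier) (xs : List A) (ys : List B) →
    ∑ (λ x → ∑ (f x) ys) xs ≈ ∑ (λ y → ∑ (λ x → f x y) xs) ys
  ∑-swap f []       ys = sym (∑-zero (λ _ → refl) ys)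
  ∑-swap f (x ∷ xs) ys = trans (+-congˡ (∑-swap f xs ys)) (sym (∑-+ (f x) (λ y → ∑ (λ x → f x y) xs) ys))

  ∑-filter : ∀ {p} {P : A → Set p} (P? : Decidable P) (f : A → Carrier) (xs : List A) →
    ∑ f (filter P? xs) ≈ ∑ (λ x → 𝟙 (does (P? x)) * f x) xs
  ∑-filter P? f [] = refl
  ∑-filter P? f (x ∷ xs) with does (P? x)
  ... | true  = +-cong (sym (*-identityˡ (f x))) (∑-filter P? f xs)
  ... | false = trans (∑-filter P? f xs) (sym (trans (+-congʳ (zeroˡ (f x))) (+-identityˡ _)))

  ∑-cartesianProduct : (F : C → Carrier) (h : A → B → C) (xs : List A) (ys : List B) →
    ∑ F (cartesianProductWith h xs ys) ≈ ∑ (λ x → ∑ (λ y → F (h x y)) ys) xs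
  ∑-cartesianProduct F h []       ys = refl
  ∑-cartesianProduct F h (x ∷ xs) ys = begin
    ∑ F (map (h x) ys ++ cartesianProductWith h xs ys)       ≈⟨ ∑-++ F (map (h x) ys) _ ⟩
    ∑ F (map (h x) ys) + ∑ F (cartesianProductWith h xs ys)
      ≈⟨ +-cong (reflexive (∑-map F (h x) ys)) (∑-cartesianProduct F h xs ys) ⟩
    ∑ (λ y → F (h x y)) ys + ∑ (λ x → ∑ (λ y → F (h x y)) ys) xs  ∎

  ∑-cartesian-* : (f : A → Carrier) (g : B → Carrier) (h : A → B → C) (F : C → Carrier) →
    (∀ x y → F (h x y) ≈ f x * g y) → ∀ xs ys → ∑ F (cartesianProductWith h xs ys) ≈ ∑ f xs * ∑ g ys
  ∑-cartesian-* f g h F F≈f*g xs ys = begin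
    ∑ F (cartesianProductWith h xs ys)    ≈⟨ ∑-cartesianProduct F h xs ys ⟩
    ∑ (λ x → ∑ (λ y → F (h x y)) ys) xs    ≈⟨ ∑-cong (λ x → ∑-cong (F≈f*g x) ys) xs ⟩
    ∑ (λ x → ∑ (λ y → f x * g y) ys) xs    ≈⟨ ∑-cong (λ x → sym (∑-*ˡ (f x) g ys)) xs ⟩
    ∑ (λ x → f x * ∑ g ys) xs              ≈⟨ sym (∑-*ʳ (∑ g ys) f xs) ⟩
    ∑ f xs * ∑ g ys                        ∎

  ∑-allFin-suc : ∀ {n} (f : Fin (suc n) → Carrier) →
    ∑ f (allFin (suc n)) ≡ f Fin.zero + ∑ (f ∘ Fin.suc) (allFin n)
  ∑-allFin-suc f = ≡.cong (foldr _+_ 0#) (map-allFin-suc f)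

  ∑-allSubsets-suc : ∀ {m} (F : Subset (suc m) → Carrier) →
    ∑ F (allSubsets (suc m)) ≈ ∑ (F ∘ (outside ∷_)) (allSubsets m) + ∑ (F ∘ (inside ∷_)) (allSubsets m)
  ∑-allSubsets-suc {m} F =
    trans (∑-cartesianProduct F _∷_ (outside ∷ inside ∷ []) (allSubsets m)) (+-congˡ (+-identityʳ _))

module ℕΣ = FiniteSums ℕP.+-*-commutativeSemiring
module ℤΣ = FiniteSums ℤP.+-*-commutativeSemiring
open ℕΣ using () renaming (∑ to ∑ℕ; 𝟙 to 𝟙ℕ)
open ℤΣ using () renaming (∑ to ∑ℤ; 𝟙 to 𝟙ℤ)

module SubsetLemmas where

  open Data.Nat using (_+_)

  ⟦_⟧ : ∀ {n p} {P : Pred (Fin n) p} → Decidable P → Subset n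
  ⟦ P? ⟧ = tabulate (does ∘ P?)

  ∈⟦⟧⇔ : ∀ {n p} {P : Pred (Fin n) p} (P? : Decidable P) {j} → j ∈ ⟦ P? ⟧ ⇔ P j
  ∈⟦⟧⇔ {P = P} P? {j} = mk⇔ to from
    where
    witness : (j? : Dec (P j)) → does j? ≡ true → P j
    witness (yes pj) _ = pj
    to : j ∈ ⟦ P? ⟧ → P j
    to j∈ = witness (P? j) (≡.trans (≡.sym (Vec.lookup∘tabulate (does ∘ P?) j)) (Vec.[]=⇒lookup j∈))
    from : P j → j ∈ ⟦ P? ⟧
    from pj = Vec.lookup⇒[]= j _ (≡.trans (Vec.lookup∘tabulate (does ∘ P?) j) (dec-true (P? j) pj))

  ⊆-∩⇔ : ∀ {t} {J A B : Subset t} → J ⊆ A ∩ B ⇔ (J ⊆ A × J ⊆ B)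
  ⊆-∩⇔ {J = J} {A} {B} = mk⇔ to from
    where
    to : J ⊆ A ∩ B → J ⊆ A × J ⊆ B
    to J⊆A∩B = (λ j∈J → p∩q⊆p A B (J⊆A∩B j∈J)) , (λ j∈J → p∩q⊆q A B (J⊆A∩B j∈J))
    from : J ⊆ A × J ⊆ B → J ⊆ A ∩ B
    from (J⊆A , J⊆B) j∈J = x∈p∩q⁺ (J⊆A j∈J , J⊆B j∈J)

  ∪⁅⁆-⊆⇔ : ∀ {t} {J X : Subset t} {i} → J ∪ ⁅ i ⁆ ⊆ X ⇔ (J ⊆ X × i ∈ X)
  ∪⁅⁆-⊆⇔ {J = J} {X} {i} = mk⇔ to from
    where
    to : J ∪ ⁅ i ⁆ ⊆ X → J ⊆ X × i ∈ X
    to J∪i⊆X = (λ j∈J → J∪i⊆X (x∈p∪q⁺ (inj₁ j∈J))) , J∪i⊆X (x∈p∪q⁺ (inj₂ (x∈⁅x⁆ i)))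
    from : J ⊆ X × i ∈ X → J ∪ ⁅ i ⁆ ⊆ X
    from (J⊆X , i∈X) j∈ with x∈p∪q⁻ J ⁅ i ⁆ j∈
    ... | inj₁ j∈J   = J⊆X j∈J
    ... | inj₂ j∈⁅i⁆ = ≡.subst (_∈ X) (≡.sym (x∈⁅y⁆⇒x≡y i j∈⁅i⁆)) i∈X

  ∣p∪q∣≤∣p∣+∣q∣ : ∀ {n} (p q : Subset n) → ∣ p ∪ q ∣ ≤ ∣ p ∣ + ∣ q ∣
  ∣p∪q∣≤∣p∣+∣q∣ []            []            = z≤n
  ∣p∪q∣≤∣p∣+∣q∣ (outside ∷ p) (outside ∷ q) = ∣p∪q∣≤∣p∣+∣q∣ p q
  ∣p∪q∣≤∣p∣+∣q∣ (outside ∷ p) (inside ∷ q)  =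
    ℕP.≤-trans (s≤s (∣p∪q∣≤∣p∣+∣q∣ p q)) (ℕP.≤-reflexive (≡.sym (ℕP.+-suc ∣ p ∣ ∣ q ∣)))
  ∣p∪q∣≤∣p∣+∣q∣ (inside ∷ p)  (outside ∷ q) = s≤s (∣p∪q∣≤∣p∣+∣q∣ p q)
  ∣p∪q∣≤∣p∣+∣q∣ (inside ∷ p)  (inside ∷ q)  =
    s≤s (ℕP.≤-trans (∣p∪q∣≤∣p∣+∣q∣ p q) (ℕP.+-monoʳ-≤ ∣ p ∣ (ℕP.n≤1+n ∣ q ∣)))

  ∈⇒1≤∣∣ : ∀ {n} {x : Fin n} {p : Subset n} → x ∈ p → 1 ≤ ∣ p ∣
  ∈⇒1≤∣∣ {x = x} {p} x∈p = ≡.subst (_≤ ∣ p ∣) (∣⁅x⁆∣≡1 x)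
    (p⊆q⇒∣p∣≤∣q∣ (λ y∈⁅x⁆ → ≡.subst (_∈ p) (≡.sym (x∈⁅y⁆⇒x≡y x y∈⁅x⁆)) x∈p))

  -- The image g(K) of K ⊆ Fin t under g : Fin t → Fin m; imageAt fs K a is image (λ j → fs j a) K.
  image : ∀ {t m} → (Fin t → Fin m) → Subset t → Subset m
  image g K = ⟦ (λ b → Fin.any? (λ j → (j ∈? K) ×-dec (g j Fin.≟ b))) ⟧

  module _ {t m} (g : Fin t → Fin m) where

    ∈-image⇔ : ∀ {K b} → b ∈ image g K ⇔ ∃ λ j → j ∈ K × g j ≡ b
    ∈-image⇔ {K} = ∈⟦⟧⇔ (λ b → Fin.any? (λ j → (j ∈? K) ×-dec (g j Fin.≟ b)))

    ∈-image : ∀ {K j} → j ∈ K → g j ∈ image g K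
    ∈-image j∈K = Equivalence.from ∈-image⇔ (_ , j∈K , ≡.refl)

    image-⊆ : ∀ {K X} → image g K ⊆ X ⇔ (∀ {j} → j ∈ K → g j ∈ X)
    image-⊆ {K} {X} = mk⇔ to from
      where
      to : image g K ⊆ X → (∀ {j} → j ∈ K → g j ∈ X)
      to g[K]⊆X j∈K = g[K]⊆X (∈-image j∈K)
      from : (∀ {j} → j ∈ K → g j ∈ X) → image g K ⊆ X
      from g[K]⊆X b∈ with j , j∈K , ≡.refl ← Equivalence.to ∈-image⇔ b∈ = g[K]⊆X j∈K

    ∣image∣≤∣∣ : ∀ K X → (∀ {j} → j ∈ K → g j ∈ X) → ∣ image g K ∣ ≤ ∣ X ∣
    ∣image∣≤∣∣ K X g[K]⊆X = p⊆q⇒∣p∣≤∣q∣ (Equivalence.from (image-⊆ {K} {X}) g[K]⊆X)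

  ∣image∣≤ : ∀ {t m} (g : Fin t → Fin m) (K : Subset t) → ∣ image g K ∣ ≤ ∣ K ∣
  ∣image∣≤ {zero}  {m} g [] = ≡.subst (∣ image g [] ∣ ≤_) (∣⊥∣≡0 m) (∣image∣≤∣∣ g [] ⊥ λ ())
  ∣image∣≤ {suc t} g (outside ∷ K) =
    ℕP.≤-trans (∣image∣≤∣∣ g (outside ∷ K) _ λ { (there j∈K) → ∈-image (g ∘ Fin.suc) j∈K })
               (∣image∣≤ (g ∘ Fin.suc) K)
  ∣image∣≤ {suc t} g (inside ∷ K) = begin
    ∣ image g (inside ∷ K) ∣                       ≤⟨ ∣image∣≤∣∣ g (inside ∷ K) _ split ⟩
    ∣ ⁅ g Fin.zero ⁆ ∪ image (g ∘ Fin.suc) K ∣      ≤⟨ ∣p∪q∣≤∣p∣+∣q∣ ⁅ g Fin.zero ⁆ _ ⟩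
    ∣ ⁅ g Fin.zero ⁆ ∣ + ∣ image (g ∘ Fin.suc) K ∣  ≡⟨ ≡.cong (_+ ∣ image (g ∘ Fin.suc) K ∣) (∣⁅x⁆∣≡1 (g Fin.zero)) ⟩
    suc ∣ image (g ∘ Fin.suc) K ∣                  ≤⟨ s≤s (∣image∣≤ (g ∘ Fin.suc) K) ⟩
    suc ∣ K ∣                                      ∎
    where
    open ℕP.≤-Reasoning
    split : ∀ {j} → j ∈ inside ∷ K → g j ∈ ⁅ g Fin.zero ⁆ ∪ image (g ∘ Fin.suc) K
    split here        = x∈p∪q⁺ (inj₁ (x∈⁅x⁆ (g Fin.zero)))
    split (there j∈K) = x∈p∪q⁺ (inj₂ (∈-image (g ∘ Fin.suc) j∈K))

  ∣image-∪⁅⁆∣≤ : ∀ {t m} (g : Fin t → Fin m) J i → ∣ image g (J ∪ ⁅ i ⁆) ∣ ≤ suc ∣ J ∣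
  ∣image-∪⁅⁆∣≤ g J i = begin
    ∣ image g (J ∪ ⁅ i ⁆) ∣  ≤⟨ ∣image∣≤ g (J ∪ ⁅ i ⁆) ⟩
    ∣ J ∪ ⁅ i ⁆ ∣            ≤⟨ ∣p∪q∣≤∣p∣+∣q∣ J ⁅ i ⁆ ⟩
    ∣ J ∣ + ∣ ⁅ i ⁆ ∣        ≡⟨ ≡.cong (∣ J ∣ +_) (∣⁅x⁆∣≡1 i) ⟩
    ∣ J ∣ + 1               ≡⟨ ℕP.+-comm ∣ J ∣ 1 ⟩
    suc ∣ J ∣               ∎
    where open ℕP.≤-Reasoning

module Counting where

  open SubsetLemmas
  open Data.Nat using (_+_; _*_)
  open ≡.≡-Reasoning
  module ℕ* = CommutativeSemigroup ℕP.*-commutativeSemigroup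

  length-filter : ∀ {a p} {A : Set a} {P : A → Set p} (P? : Decidable P) (xs : List A) →
    length (filter P? xs) ≡ ∑ℕ (λ x → 𝟙ℕ (does (P? x))) xs
  length-filter P? []       = ≡.refl
  length-filter P? (x ∷ xs) with does (P? x)
  ... | true  = ≡.cong suc (length-filter P? xs)
  ... | false = length-filter P? xs

  -- binomP m d s counts the d-element subsets of an m-element set containing a fixed
  -- s-element set.  Shrinking the universe, the size and the forced set by one element:
  binomP-suc : ∀ m d s → binomP (suc m) (suc d) (suc s) ≡ binomP m d s
  binomP-suc m d zero    = ≡.refl
  binomP-suc m d (suc s) = ≡.refl

  binomP-size-zero : ∀ m s → binomP m 0 s ≡ binomP (suc m) 0 s
  binomP-size-zero m zero    = ≡.refl
  binomP-size-zero m (suc s) = ≡.refl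

  binomP-pascal : ∀ m d s → s ≤ m → binomP m (suc d) s + binomP m d s ≡ binomP (suc m) (suc d) s
  binomP-pascal m       d       zero          _         =
    ≡.trans (ℕP.+-comm (m C suc d) (m C d)) (nCk+nC[k+1]≡[n+1]C[k+1] m d)
  binomP-pascal (suc m) zero    (suc zero)    _         = ≡.refl
  binomP-pascal (suc m) zero    (suc (suc s)) _         = ≡.refl
  binomP-pascal (suc m) (suc d) (suc s)       (s≤s s≤m) = begin
    binomP (suc m) (suc (suc d)) (suc s) + binomP (suc m) (suc d) (suc s)
      ≡⟨ ≡.cong₂ _+_ (binomP-suc m (suc d) s) (binomP-suc m d s) ⟩
    binomP m (suc d) s + binomP m d s
      ≡⟨ binomP-pascal m d s s≤m ⟩
    binomP (suc m) (suc d) s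
      ≡⟨ binomP-suc (suc m) (suc d) s ⟨
    binomP (suc (suc m)) (suc (suc d)) (suc s)
      ∎

  supersets-count : ∀ m d (S : Subset m) →
    ∑ℕ (λ X → 𝟙ℕ (does (S ⊆? X) ∧ does (∣ X ∣ ≟ d))) (allSubsets m) ≡ binomP m d ∣ S ∣
  supersets-count zero    zero    [] = ≡.refl
  supersets-count zero    (suc d) [] = ≡.refl
  supersets-count (suc m) d (s ∷ S) =
    ≡.trans (ℕΣ.∑-allSubsets-suc {m} (λ X → 𝟙ℕ (does (s ∷ S ⊆? X) ∧ does (∣ X ∣ ≟ d))))
            (by-membership-of-zero s d)
    where
    count : ℕ → ℕ
    count d = ∑ℕ (λ X → 𝟙ℕ (does (S ⊆? X) ∧ does (∣ X ∣ ≟ d))) (allSubsets m)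
    with-zero : ℕ → ℕ
    with-zero d = ∑ℕ (λ X → 𝟙ℕ (does (S ⊆? X) ∧ does (suc ∣ X ∣ ≟ d))) (allSubsets m)
    none-with-zero : with-zero 0 ≡ 0
    none-with-zero = ℕΣ.∑-zero (λ X → ≡.cong 𝟙ℕ (Bool.∧-zeroʳ (does (S ⊆? X)))) (allSubsets m)
    -- a superset of s ∷ S in Fin (suc m) either avoids 0 (only possible if s = outside) or contains it
    by-membership-of-zero : ∀ s d → let F = λ X → 𝟙ℕ (does (s ∷ S ⊆? X) ∧ does (∣ X ∣ ≟ d)) in
      ∑ℕ (F ∘ (outside ∷_)) (allSubsets m) + ∑ℕ (F ∘ (inside ∷_)) (allSubsets m) ≡ binomP (suc m) d ∣ s ∷ S ∣
    by-membership-of-zero inside  zero    =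
      ≡.cong₂ _+_ (ℕΣ.∑-zero (λ _ → ≡.refl) (allSubsets m)) none-with-zero
    by-membership-of-zero inside  (suc d) = begin
      ∑ℕ (λ _ → 0) (allSubsets m) + count d  ≡⟨ ≡.cong (_+ count d) (ℕΣ.∑-zero (λ _ → ≡.refl) (allSubsets m)) ⟩
      count d                               ≡⟨ supersets-count m d S ⟩
      binomP m d ∣ S ∣                      ≡⟨ binomP-suc m d ∣ S ∣ ⟨
      binomP (suc m) (suc d) (suc ∣ S ∣)    ∎
    by-membership-of-zero outside zero    = begin
      count 0 + with-zero 0                 ≡⟨ ≡.cong₂ _+_ (supersets-count m 0 S) none-with-zero ⟩
      binomP m 0 ∣ S ∣ + 0                  ≡⟨ ℕP.+-identityʳ _ ⟩
      binomP m 0 ∣ S ∣                      ≡⟨ binomP-size-zero m ∣ S ∣ ⟩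
      binomP (suc m) 0 ∣ S ∣                ∎
    by-membership-of-zero outside (suc d) = begin
      count (suc d) + count d               ≡⟨ ≡.cong₂ _+_ (supersets-count m (suc d) S) (supersets-count m d S) ⟩
      binomP m (suc d) ∣ S ∣ + binomP m d ∣ S ∣  ≡⟨ binomP-pascal m d ∣ S ∣ (∣p∣≤n S) ⟩
      binomP (suc m) (suc d) ∣ S ∣          ∎

  sequences-count : ∀ n m {q} {Q : Fin n → Pred (Subset m) q} (Q? : ∀ a → Decidable (Q a)) →
    ∑ℕ (λ L → 𝟙ℕ (does (Fin.all? (λ a → Q? a (lookup L a))))) (allSeqs n m)
      ≡ prodℕ (map (λ a → ∑ℕ (λ X → 𝟙ℕ (does (Q? a X))) (allSubsets m)) (allFin n))
  sequences-count zero    m Q? = ≡.refl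
  sequences-count (suc n) m {Q = Q} Q? = begin
    ∑ℕ (𝟙ℕ ∘ does ∘ all?) (allSeqs (suc n) m)
      ≡⟨ ℕΣ.∑-cartesian-* (𝟙ℕ ∘ does ∘ Q? Fin.zero) (𝟙ℕ ∘ does ∘ rest?) _∷_ (𝟙ℕ ∘ does ∘ all?)
                           head-and-rest (allSubsets m) (allSeqs n m) ⟩
    choices Fin.zero * ∑ℕ (𝟙ℕ ∘ does ∘ rest?) (allSeqs n m)
      ≡⟨ ≡.cong (choices Fin.zero *_) (sequences-count n m (Q? ∘ Fin.suc)) ⟩
    choices Fin.zero * prodℕ (map (choices ∘ Fin.suc) (allFin n))
      ≡⟨ ≡.cong prodℕ (map-allFin-suc choices) ⟨
    prodℕ (map choices (allFin (suc n)))
      ∎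
    where
    choices : Fin (suc n) → ℕ
    choices a = ∑ℕ (λ X → 𝟙ℕ (does (Q? a X))) (allSubsets m)
    all? : (L : Seq (suc n) m) → Dec (∀ a → Q a (lookup L a))
    all? L = Fin.all? (λ a → Q? a (lookup L a))
    rest? : (L : Seq n m) → Dec (∀ a → Q (Fin.suc a) (lookup L a))
    rest? L = Fin.all? (λ a → Q? (Fin.suc a) (lookup L a))
    head-and-rest : ∀ X L → 𝟙ℕ (does (all? (X ∷ L))) ≡ 𝟙ℕ (does (Q? Fin.zero X)) * 𝟙ℕ (does (rest? L))
    head-and-rest X L = ℕΣ.𝟙-×⇔ (⇔-sym Fin.∀-cons-⇔) (all? (X ∷ L)) (Q? Fin.zero X) (rest? L)

  module Regroup {a} {A : Set a} (g : ℕ → ℕ) (v : A → ℕ) where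

    multiplicity : List A → ℕ → ℕ
    multiplicity xs p = length (filter (λ x → v x ≟ p) xs)

    grouped : List A → List ℕ → ℕ
    grouped xs ps = prodℕ (map (λ p → g p ^ multiplicity xs p) ps)

    grouped-[] : ∀ ps → grouped [] ps ≡ 1
    grouped-[] []       = ≡.refl
    grouped-[] (p ∷ ps) = ≡.trans (ℕP.*-identityˡ _) (grouped-[] ps)

    grouped-∉ : ∀ x xs ps → v x ∉ₗ ps → grouped (x ∷ xs) ps ≡ grouped xs ps
    grouped-∉ x xs []       _   = ≡.refl
    grouped-∉ x xs (p ∷ ps) vx∉ = ≡.cong₂ _*_
      (≡.cong (λ ys → g p ^ length ys) (List.filter-reject (λ x → v x ≟ p) (vx∉ ∘ Any.here)))
      (grouped-∉ x xs ps (vx∉ ∘ Any.there))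

    grouped-∈ : ∀ x xs ps → Unique ps → v x ∈ₗ ps → grouped (x ∷ xs) ps ≡ g (v x) * grouped xs ps
    grouped-∈ x xs (p ∷ ps) u (Any.here ≡.refl) = begin
      g p ^ multiplicity (x ∷ xs) p * grouped (x ∷ xs) ps
        ≡⟨ ≡.cong₂ (λ k r → g p ^ k * r) (≡.cong length (List.filter-accept (λ x → v x ≟ p) ≡.refl))
                                           (grouped-∉ x xs ps (Unique.Unique[x∷xs]⇒x∉xs u)) ⟩
      g p * g p ^ multiplicity xs p * grouped xs ps
        ≡⟨ ℕP.*-assoc (g p) _ _ ⟩
      g p * grouped xs (p ∷ ps)
        ∎
    grouped-∈ x xs (p ∷ ps) u@(_ ∷ unique) (Any.there vx∈) = begin
      g p ^ multiplicity (x ∷ xs) p * grouped (x ∷ xs) ps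
        ≡⟨ ≡.cong₂ (λ k r → g p ^ k * r) (≡.cong length (List.filter-reject (λ x → v x ≟ p) vx≢p))
                                           (grouped-∈ x xs ps unique vx∈) ⟩
      g p ^ multiplicity xs p * (g (v x) * grouped xs ps)
        ≡⟨ ℕ*.x∙yz≈y∙xz (g p ^ multiplicity xs p) (g (v x)) _ ⟩
      g (v x) * grouped xs (p ∷ ps)
        ∎
      where
      vx≢p : ¬ v x ≡ p
      vx≢p ≡.refl = Unique.Unique[x∷xs]⇒x∉xs u vx∈

    regroup : ∀ ps → Unique ps → (∀ x → v x ∈ₗ ps) → ∀ xs → prodℕ (map (g ∘ v) xs) ≡ grouped xs ps
    regroup ps unique covers []       = ≡.sym (grouped-[] ps)
    regroup ps unique covers (x ∷ xs) = ≡.trans (≡.cong (g (v x) *_) (regroup ps unique covers xs))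
                                                (≡.sym (grouped-∈ x xs ps unique (covers x)))

  range-unique : ∀ k → Unique (map suc (upTo k))
  range-unique k = Unique.map⁺ ℕP.suc-injective (Unique.upTo⁺ k)

  ∈-range : ∀ {k u} → 1 ≤ u → u ≤ k → u ∈ₗ map suc (upTo k)
  ∈-range {u = suc u} (s≤s _) u≤k = ∈-map⁺ suc (∈-upTo⁺ u≤k)

  module _ {t n m : ℕ} (d : ℕ) (fs : Fin t → Fin n → Fin m) where

    witnesses : Seq n m → Subset t
    witnesses L = ⟦ (λ j → related? d (fs j) L) ⟧

    ∈-witnesses⇔ : ∀ L {j} → j ∈ witnesses L ⇔ Related d (fs j) L
    ∈-witnesses⇔ L = ∈⟦⟧⇔ (λ j → related? d (fs j) L)

    related-to-all⇔ : ∀ {i K} → i ∈ K → (L : Seq n m) →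
      K ⊆ witnesses L ⇔ (∀ a → imageAt fs K a ⊆ lookup L a × ∣ lookup L a ∣ ≡ d)
    related-to-all⇔ {i} {K} i∈K L = mk⇔ to from
      where
      related : ∀ {j} → j ∈ K → K ⊆ witnesses L → Related d (fs j) L
      related j∈K K⊆W = Equivalence.to (∈-witnesses⇔ L) (K⊆W j∈K)
      to : K ⊆ witnesses L → ∀ a → imageAt fs K a ⊆ lookup L a × ∣ lookup L a ∣ ≡ d
      to K⊆W a = Equivalence.from (image-⊆ (λ j → fs j a)) (λ j∈K → proj₂ (related j∈K K⊆W a))
               , proj₁ (related i∈K K⊆W a)
      from : (∀ a → imageAt fs K a ⊆ lookup L a × ∣ lookup L a ∣ ≡ d) → K ⊆ witnesses L
      from entries j∈K = Equivalence.from (∈-witnesses⇔ L) λ a →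
        proj₂ (entries a) , Equivalence.to (image-⊆ (λ j → fs j a)) (proj₁ (entries a)) j∈K

    related-count : ∀ {i K} → i ∈ K →
      ∑ℕ (λ L → 𝟙ℕ (does (K ⊆? witnesses L))) (allSeqs n m)
        ≡ prodℕ (map (λ a → binomP m d ∣ imageAt fs K a ∣) (allFin n))
    related-count {i} {K} i∈K = begin
      ∑ℕ (λ L → 𝟙ℕ (does (K ⊆? witnesses L))) (allSeqs n m)
        ≡⟨ ℕΣ.∑-cong (λ L → ≡.cong 𝟙ℕ (does-⇔ (related-to-all⇔ i∈K L) (K ⊆? witnesses L) (entries? L)))
                     (allSeqs n m) ⟩
      ∑ℕ (λ L → 𝟙ℕ (does (entries? L))) (allSeqs n m)
        ≡⟨ sequences-count n m entry? ⟩
      prodℕ (map (λ a → ∑ℕ (λ X → 𝟙ℕ (does (entry? a X))) (allSubsets m)) (allFin n))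
        ≡⟨ ≡.cong prodℕ (List.map-cong (λ a → supersets-count m d (imageAt fs K a)) (allFin n)) ⟩
      prodℕ (map (λ a → binomP m d ∣ imageAt fs K a ∣) (allFin n))
        ∎
      where
      entry? : ∀ a X → Dec (imageAt fs K a ⊆ X × ∣ X ∣ ≡ d)
      entry? a X = (imageAt fs K a ⊆? X) ×-dec (∣ X ∣ ≟ d)
      entries? : (L : Seq n m) → Dec (∀ a → imageAt fs K a ⊆ lookup L a × ∣ lookup L a ∣ ≡ d)
      entries? L = Fin.all? (λ a → entry? a (lookup L a))

    -- Grouping the entries a by p = |{f_j(a) : j ∈ J ∪ {i}}| ∈ {1, …, |J| + 1}.
    related-count-grouped : ∀ i J →
      ∑ℕ (λ L → 𝟙ℕ (does (J ∪ ⁅ i ⁆ ⊆? witnesses L))) (allSeqs n m)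
        ≡ prodℕ (map (λ p → binomP m d p ^ nJ fs (J ∪ ⁅ i ⁆) p) (map suc (upTo (suc ∣ J ∣))))
    related-count-grouped i J =
      ≡.trans (related-count i∈K)
              (Regroup.regroup (binomP m d) size (map suc (upTo (suc ∣ J ∣))) (range-unique _) size∈range (allFin n))
      where
      K = J ∪ ⁅ i ⁆
      i∈K : i ∈ K
      i∈K = x∈p∪q⁺ (inj₂ (x∈⁅x⁆ i))
      size : Fin n → ℕ
      size a = ∣ imageAt fs K a ∣
      size∈range : ∀ a → size a ∈ₗ map suc (upTo (suc ∣ J ∣))
      size∈range a = ∈-range (∈⇒1≤∣∣ (∈-image (λ j → fs j a) i∈K)) (∣image-∪⁅⁆∣≤ (λ j → fs j a) J i)

open SubsetLemmas
open Counting
open Data.Integer using (+_; _+_; _-_; _*_; -1ℤ)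
open import Data.Integer.Tactic.RingSolver using (solve-∀)
open ≡.≡-Reasoning

+-count : ∀ {a} {A : Set a} (b : A → Bool) (xs : List A) → + ∑ℕ (𝟙ℕ ∘ b) xs ≡ ∑ℤ (𝟙ℤ ∘ b) xs
+-count b []       = ≡.refl
+-count b (x ∷ xs) = ≡.trans (ℤP.pos-+ (𝟙ℕ (b x)) (∑ℕ (𝟙ℕ ∘ b) xs)) (≡.cong₂ _+_ (+𝟙 (b x)) (+-count b xs))
  where
  +𝟙 : ∀ b → + 𝟙ℕ b ≡ 𝟙ℤ b
  +𝟙 true  = ≡.refl
  +𝟙 false = ≡.refl

below : ∀ {t} → Fin t → Subset t
below i = ⟦ (λ j → toℕ j <? toℕ i) ⟧

below⇔ : ∀ {t} (i : Fin t) {j} → j ∈ below i ⇔ toℕ j < toℕ i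
below⇔ i = ∈⟦⟧⇔ (λ j → toℕ j <? toℕ i)

belowIdx⇔ : ∀ {t} {i : Fin t} {J} → BelowIdx i J ⇔ J ⊆ below i
belowIdx⇔ {i = i} = mk⇔ (λ J<i {j} j∈J → Equivalence.from (below⇔ i) (J<i j j∈J))
                        (λ J⊆below j j∈J → Equivalence.to (below⇔ i) (J⊆below j∈J))

-- Every nonempty W has exactly one least element:
-- [W ≠ ∅] = Σ_i [i ∈ W] · [no element of W lies below i].
first-element : ∀ {t} (W : Subset t) →
  ∑ℤ (λ i → 𝟙ℤ (does (i ∈? W)) * 𝟙ℤ (does (below i ∩ W ⊆? ⊥))) (allFin t) ≡ 𝟙ℤ (does (nonempty? W))
first-element {zero}  []      = ≡.refl
first-element {suc t} (b ∷ W) = begin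
  ∑ℤ f (allFin (suc t))
    ≡⟨ ℤΣ.∑-allFin-suc f ⟩
  f Fin.zero + ∑ℤ (f ∘ Fin.suc) (allFin t)
    ≡⟨ ≡.cong (_+ ∑ℤ (f ∘ Fin.suc) (allFin t)) zero-is-least ⟩
  𝟙ℤ (does (Fin.zero ∈? b ∷ W)) + ∑ℤ (f ∘ Fin.suc) (allFin t)
    ≡⟨ by-membership-of-zero b ⟩
  𝟙ℤ (does (nonempty? (b ∷ W)))
    ∎
  where
  f : Fin (suc t) → ℤ
  f i = 𝟙ℤ (does (i ∈? b ∷ W)) * 𝟙ℤ (does (below i ∩ (b ∷ W) ⊆? ⊥))
  nothing-below-zero : below Fin.zero ∩ (b ∷ W) ⊆ ⊥
  nothing-below-zero j∈ =
    ⊥-elim (ℕP.n≮0 (Equivalence.to (below⇔ Fin.zero) (p∩q⊆p (below Fin.zero) (b ∷ W) j∈)))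
  zero-is-least : f Fin.zero ≡ 𝟙ℤ (does (Fin.zero ∈? b ∷ W))
  zero-is-least = ≡.trans
    (≡.cong (λ x → 𝟙ℤ (does (Fin.zero ∈? b ∷ W)) * 𝟙ℤ x) (dec-true (_ ⊆? ⊥) nothing-below-zero))
    (ℤP.*-identityʳ _)
  -- if 0 ∈ W it is the least element; otherwise the least element of W is that of its tail
  by-membership-of-zero : ∀ b →
    𝟙ℤ (does (Fin.zero ∈? b ∷ W)) + ∑ℤ (λ i → 𝟙ℤ (does (i ∈? W)) * 𝟙ℤ (does (b ∷ (below i ∩ W) ⊆? ⊥))) (allFin t)
      ≡ 𝟙ℤ (does (nonempty? (b ∷ W)))
  by-membership-of-zero inside  =
    ≡.cong (_+_ (+ 1)) (ℤΣ.∑-zero (λ i → ℤP.*-zeroʳ (𝟙ℤ (does (i ∈? W)))) (allFin t))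
  by-membership-of-zero outside = begin
    + 0 + tail-sum                        ≡⟨ ℤP.+-identityˡ tail-sum ⟩
    tail-sum                              ≡⟨ first-element W ⟩
    𝟙ℤ (does (nonempty? W))               ≡⟨ ≡.cong 𝟙ℤ (does-⇔ shift (nonempty? W) (nonempty? (outside ∷ W))) ⟩
    𝟙ℤ (does (nonempty? (outside ∷ W)))   ∎
    where
    tail-sum : ℤ
    tail-sum = ∑ℤ (λ i → 𝟙ℤ (does (i ∈? W)) * 𝟙ℤ (does (below i ∩ W ⊆? ⊥))) (allFin t)
    shift : Nonempty W ⇔ Nonempty (outside ∷ W)
    shift = mk⇔ (λ (j , j∈) → Fin.suc j , there j∈) λ { (Fin.suc j , there j∈) → j , j∈ }

-- Σ_{J ⊆ X} (-1)^{|J|} = [X = ∅], the binomial expansion of (1 - 1)^{|X|}.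
alternating-sum : ∀ {t} (X : Subset t) →
  ∑ℤ (λ J → 𝟙ℤ (does (J ⊆? X)) * sign ∣ J ∣) (allSubsets t) ≡ 𝟙ℤ (does (X ⊆? ⊥))
alternating-sum {zero}  []            = ≡.refl
alternating-sum {suc t} (outside ∷ X) = begin
  ∑ℤ F (allSubsets (suc t))
    ≡⟨ ℤΣ.∑-allSubsets-suc F ⟩
  ∑ℤ (F ∘ (outside ∷_)) (allSubsets t) + ∑ℤ (F ∘ (inside ∷_)) (allSubsets t)
    ≡⟨ ≡.cong₂ _+_ (alternating-sum X) (ℤΣ.∑-zero (λ J → ℤP.*-zeroˡ (sign (suc ∣ J ∣))) (allSubsets t)) ⟩
  𝟙ℤ (does (X ⊆? ⊥)) + + 0
    ≡⟨ ℤP.+-identityʳ _ ⟩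
  𝟙ℤ (does (X ⊆? ⊥))
    ∎
  where
  F : Subset (suc t) → ℤ
  F J = 𝟙ℤ (does (J ⊆? outside ∷ X)) * sign ∣ J ∣
alternating-sum {suc t} (inside ∷ X) = begin
  ∑ℤ F (allSubsets (suc t))
    ≡⟨ ℤΣ.∑-allSubsets-suc F ⟩
  ∑ℤ G 𝒫 + ∑ℤ (F ∘ (inside ∷_)) 𝒫
    ≡⟨ ≡.cong (_+_ (∑ℤ G 𝒫)) (ℤΣ.∑-cong (λ J → ℤ*.x∙yz≈y∙xz (𝟙ℤ (does (J ⊆? X))) -1ℤ (sign ∣ J ∣)) 𝒫) ⟩
  ∑ℤ G 𝒫 + ∑ℤ (λ J → -1ℤ * G J) 𝒫
    ≡⟨ ≡.cong (_+_ (∑ℤ G 𝒫)) (ℤΣ.∑-*ˡ -1ℤ G 𝒫) ⟨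
  ∑ℤ G 𝒫 + -1ℤ * ∑ℤ G 𝒫
    ≡⟨ ≡.cong (_+_ (∑ℤ G 𝒫)) (ℤP.-1*i≡-i (∑ℤ G 𝒫)) ⟩
  ∑ℤ G 𝒫 - ∑ℤ G 𝒫
    ≡⟨ ℤP.+-inverseʳ (∑ℤ G 𝒫) ⟩
  + 0
    ∎
  where
  module ℤ* = CommutativeSemigroup ℤP.*-commutativeSemigroup
  𝒫 = allSubsets t
  F : Subset (suc t) → ℤ
  F J = 𝟙ℤ (does (J ⊆? inside ∷ X)) * sign ∣ J ∣
  G : Subset t → ℤ
  G J = 𝟙ℤ (does (J ⊆? X)) * sign ∣ J ∣

module _ {t n m : ℕ} (d : ℕ) (fs : Fin t → Fin n → Fin m) where

  contribution : Fin t → Subset t → Seq n m → ℤ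
  contribution i J L = 𝟙ℤ (does (belowIdx? i J)) * (sign ∣ J ∣ * 𝟙ℤ (does (J ∪ ⁅ i ⁆ ⊆? witnesses d fs L)))

  -- [L ∈ B] = Σ_i Σ_{J ⊆ {j < i}} (-1)^{|J|} [J ∪ {i} ⊆ W(L)]: classify by the least witness i,
  -- then expand "no witness below i" by inclusion–exclusion.
  membership-expansion : ∀ L →
    𝟙ℤ (does (inB? d fs L)) ≡ ∑ℤ (λ i → ∑ℤ (λ J → contribution i J L) (allSubsets t)) (allFin t)
  membership-expansion L = begin
    𝟙ℤ (does (inB? d fs L))
      ≡⟨ ≡.cong 𝟙ℤ (does-⇔ inB⇔nonempty (inB? d fs L) (nonempty? W)) ⟩
    𝟙ℤ (does (nonempty? W))
      ≡⟨ first-element W ⟨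
    ∑ℤ (λ i → 𝟙ℤ (does (i ∈? W)) * 𝟙ℤ (does (below i ∩ W ⊆? ⊥))) (allFin t)
      ≡⟨ ℤΣ.∑-cong (λ i → ≡.cong (𝟙ℤ (does (i ∈? W)) *_) (alternating-sum (below i ∩ W))) (allFin t) ⟨
    ∑ℤ (λ i → 𝟙ℤ (does (i ∈? W)) * ∑ℤ (λ J → 𝟙ℤ (does (J ⊆? below i ∩ W)) * sign ∣ J ∣) 𝒫) (allFin t)
      ≡⟨ ℤΣ.∑-cong (λ i → ℤΣ.∑-*ˡ (𝟙ℤ (does (i ∈? W))) (λ J → 𝟙ℤ (does (J ⊆? below i ∩ W)) * sign ∣ J ∣) 𝒫)
                   (allFin t) ⟩
    ∑ℤ (λ i → ∑ℤ (λ J → 𝟙ℤ (does (i ∈? W)) * (𝟙ℤ (does (J ⊆? below i ∩ W)) * sign ∣ J ∣)) 𝒫) (allFin t)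
      ≡⟨ ℤΣ.∑-cong (λ i → ℤΣ.∑-cong (rearrange i) 𝒫) (allFin t) ⟩
    ∑ℤ (λ i → ∑ℤ (λ J → contribution i J L) 𝒫) (allFin t)
      ∎
    where
    W = witnesses d fs L
    𝒫 = allSubsets t
    inB⇔nonempty : InB d fs L ⇔ Nonempty W
    inB⇔nonempty = mk⇔ (λ (j , r) → j , Equivalence.from (∈-witnesses⇔ d fs L) r)
                       (λ (j , j∈W) → j , Equivalence.to (∈-witnesses⇔ d fs L) j∈W)
    rearrange : ∀ i J → 𝟙ℤ (does (i ∈? W)) * (𝟙ℤ (does (J ⊆? below i ∩ W)) * sign ∣ J ∣) ≡ contribution i J L
    rearrange i J = begin
      𝟙ℤ (does (i ∈? W)) * (𝟙ℤ (does (J ⊆? below i ∩ W)) * sign ∣ J ∣)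
        ≡⟨ ≡.cong (λ x → 𝟙ℤ (does (i ∈? W)) * (x * sign ∣ J ∣))
                  (ℤΣ.𝟙-×⇔ ⊆-∩⇔ (J ⊆? below i ∩ W) (J ⊆? below i) (J ⊆? W)) ⟩
      𝟙ℤ (does (i ∈? W)) * ((𝟙ℤ (does (J ⊆? below i)) * 𝟙ℤ (does (J ⊆? W))) * sign ∣ J ∣)
        ≡⟨ reorder (𝟙ℤ (does (i ∈? W))) (𝟙ℤ (does (J ⊆? below i))) (𝟙ℤ (does (J ⊆? W))) (sign ∣ J ∣) ⟩
      𝟙ℤ (does (J ⊆? below i)) * (sign ∣ J ∣ * (𝟙ℤ (does (J ⊆? W)) * 𝟙ℤ (does (i ∈? W))))
        ≡⟨ ≡.cong₂ (λ x y → x * (sign ∣ J ∣ * y))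
                   (≡.cong 𝟙ℤ (does-⇔ belowIdx⇔ (belowIdx? i J) (J ⊆? below i)))
                   (ℤΣ.𝟙-×⇔ ∪⁅⁆-⊆⇔ (J ∪ ⁅ i ⁆ ⊆? W) (J ⊆? W) (i ∈? W)) ⟨
      contribution i J L
        ∎
      where
      reorder : ∀ x b w s → x * ((b * w) * s) ≡ b * (s * (w * x))
      reorder = solve-∀

  ∑-contribution : ∀ i J → ∑ℤ (contribution i J) (allSeqs n m) ≡ 𝟙ℤ (does (belowIdx? i J)) * termS d fs i J
  ∑-contribution i J = begin
    ∑ℤ (contribution i J) U
      ≡⟨ ℤΣ.∑-*ˡ [J<i] (λ L → sign ∣ J ∣ * related L) U ⟨
    [J<i] * ∑ℤ (λ L → sign ∣ J ∣ * related L) U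
      ≡⟨ ≡.cong ([J<i] *_) (ℤΣ.∑-*ˡ (sign ∣ J ∣) related U) ⟨
    [J<i] * (sign ∣ J ∣ * ∑ℤ related U)
      ≡⟨ ≡.cong (λ x → [J<i] * (sign ∣ J ∣ * x)) (+-count relatedᵇ U) ⟨
    [J<i] * (sign ∣ J ∣ * + ∑ℕ (𝟙ℕ ∘ relatedᵇ) U)
      ≡⟨ ≡.cong (λ x → [J<i] * (sign ∣ J ∣ * + x)) (related-count-grouped d fs i J) ⟩
    [J<i] * termS d fs i J
      ∎
    where
    U = allSeqs n m
    [J<i] = 𝟙ℤ (does (belowIdx? i J))
    relatedᵇ : Seq n m → Bool
    relatedᵇ L = does (J ∪ ⁅ i ⁆ ⊆? witnesses d fs L)
    related : Seq n m → ℤ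
    related = 𝟙ℤ ∘ relatedᵇ

  cardB-as-sum : + cardB d fs ≡ ∑ℤ (λ L → 𝟙ℤ (does (inB? d fs L))) (allSeqs n m)
  cardB-as-sum = ≡.trans (≡.cong +_ (length-filter (inB? d fs) (allSeqs n m)))
                         (+-count (does ∘ inB? d fs) (allSeqs n m))

mainTheorem3 : (t n m d : ℕ) (fs : Fin t → Fin n → Fin m) →
    d ≤ n → d ≤ m →
    + cardB d fs ≡ sumS d fs
mainTheorem3 t n m d fs _ _ = begin
  + cardB d fs
    ≡⟨ cardB-as-sum d fs ⟩
  ∑ℤ (λ L → 𝟙ℤ (does (inB? d fs L))) U
    ≡⟨ ℤΣ.∑-cong (membership-expansion d fs) U ⟩
  ∑ℤ (λ L → ∑ℤ (λ i → ∑ℤ (λ J → contribution d fs i J L) 𝒫) (allFin t)) U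
    ≡⟨ ℤΣ.∑-swap _ U (allFin t) ⟩
  ∑ℤ (λ i → ∑ℤ (λ L → ∑ℤ (λ J → contribution d fs i J L) 𝒫) U) (allFin t)
    ≡⟨ ℤΣ.∑-cong (λ i → ℤΣ.∑-swap _ U 𝒫) (allFin t) ⟩
  ∑ℤ (λ i → ∑ℤ (λ J → ∑ℤ (contribution d fs i J) U) 𝒫) (allFin t)
    ≡⟨ ℤΣ.∑-cong (λ i → ℤΣ.∑-cong (∑-contribution d fs i) 𝒫) (allFin t) ⟩
  ∑ℤ (λ i → ∑ℤ (λ J → 𝟙ℤ (does (belowIdx? i J)) * termS d fs i J) 𝒫) (allFin t)
    ≡⟨ ℤΣ.∑-cong (λ i → ℤΣ.∑-filter (belowIdx? i) (termS d fs i) 𝒫) (allFin t) ⟨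
  sumS d fs
    ∎
  where
  U = allSeqs n m
  𝒫 = allSubsets t
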